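{- There exists an absolute constant $\epsilon>0$ such that for all integers $1\leq r<n$ and every $(n,r)$-code matrix $A$, we have $\mathrm{opt}(A)\leq 2^n\left(\mathrm{lin}(A)/2^n\right)^{\epsilon}$, equivalently $\mathrm{opt}(A)\leq 2^{n-\epsilon\cdot\mathrm{mr}(A)}$.
   Context: A $(0,1,\ast)$-matrix is a matrix with entries in $\{0,1,\ast\}$; all arithmetic is over $GF_2$. A completion of $A$ is a $(0,1)$-matrix obtained from $A$ by replacing each $\ast$ by $0$ or $1$; $\mathrm{mr}(A)$ (min-rank) is the smallest $GF_2$-rank of a completion. For an $m$-by-$n$ $A=(a_{ij})$, an operator $G=(g_1,\dots,g_m):\{0,1\}^n\to\{0,1\}^m$ is consistent with $A$ if each $g_i$ depends only on the variables $x_j$ with $a_{ij}=\ast$. A set $L\subseteq\{0,1\}^n$ is a solution for $A$ if there exist a completion $M$ of $A$ and an operator $G$ consistent with $A$ with $M\mathbf{x}=G(\mathbf{x})$ for all $\mathbf{x}\in L$; it is linear if it is a linear subspace. $\mathrm{opt}(A)$ and $\mathrm{lin}(A)$ are the maximum sizes of a solution and of a linear solution, respectively ($\mathrm{lin}(A)=2^{n-\mathrm{mr}(A)}$). An $(n,r)$-code matrix is the $(0,1,\ast)$-matrix with $n$ columns and $(r+1)\binom{n}{r}$ rows constructed as follows: for every $r$-element subset $S\subseteq[n]$ it contains the $r+1$ rows $\mathbf{a}$ with $a_i=\ast$ for $i\notin S$, $a_i\in\{0,1\}$ for $i\in S$, and at most one $i\in S$ with $a_i=0$. -}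

module Defs where

open import Data.Nat using (ℕ; zero; suc; _≤_)
open import Data.Bool using (Bool; true; false; _∧_; _xor_)
open import Data.Fin using (Fin; zero; suc; _≟_)
open import Data.Fin.Subset using (Subset; ∣_∣)
open import Data.Vec using (Vec; lookup)
open import Data.List using (List)
open import Data.List.Relation.Unary.All using (All)
open import Data.Maybe using (Maybe; just; nothing)
open import Data.Product using (Σ; _×_; _,_)
open import Data.Unit using (⊤)
open import Relation.Binary.PropositionalEquality using (_≡_)
open import Relation.Nullary using (¬_; yes; no)

data Entry : Set where
  𝟘 𝟙 ⋆ : Entry

ZOSMatrix : Set → ℕ → Set
ZOSMatrix I n = I → Fin n → Entry

BMatrix : Set → ℕ → Set
BMatrix I n = I → Fin n → Bool

sumF : ∀ {n} → (Fin n → Bool) → Bool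
sumF {zero} f = false
sumF {suc n} f = f zero xor sumF (λ j → f (suc j))

Fits : Entry → Bool → Set
Fits 𝟘 b = b ≡ false
Fits 𝟙 b = b ≡ true
Fits ⋆ b = ⊤

IsCompletion : ∀ {I n} → ZOSMatrix I n → BMatrix I n → Set
IsCompletion A M = ∀ i j → Fits (A i j) (M i j)

mulVec : ∀ {I n} → BMatrix I n → Vec Bool n → I → Bool
mulVec M x i = sumF (λ j → M i j ∧ lookup x j)

Consistent : ∀ {I n} → ZOSMatrix I n → (I → Vec Bool n → Bool) → Set
Consistent A G = ∀ i x y → (∀ j → A i j ≡ ⋆ → lookup x j ≡ lookup y j) → G i x ≡ G i y

IsSolution : ∀ {I n} → ZOSMatrix I n → List (Vec Bool n) → Set
IsSolution {I} {n} A L =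
  Σ (BMatrix I n) λ M → IsCompletion A M ×
  Σ (I → Vec Bool n → Bool) λ G → Consistent A G ×
  All (λ x → ∀ i → mulVec M x i ≡ G i x) L

LinIndep : ∀ {k n} → (Fin k → Fin n → Bool) → Set
LinIndep {k} rows = ∀ (c : Fin k → Bool) →
  (∀ j → sumF (λ t → c t ∧ rows t j) ≡ false) → ∀ t → c t ≡ false

HasIndepRows : ∀ {I n} → BMatrix I n → ℕ → Set
HasIndepRows {I} M k = Σ (Fin k → I) λ f → LinIndep (λ t → M (f t))

HasRank : ∀ {I n} → BMatrix I n → ℕ → Set
HasRank M k = HasIndepRows M k × ¬ HasIndepRows M (suc k)

IsMinRank : ∀ {I n} → ZOSMatrix I n → ℕ → Set
IsMinRank {I} {n} A k =
  (Σ (BMatrix I n) λ M → IsCompletion A M × HasRank M k) ×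
  (∀ (M : BMatrix I n) j → IsCompletion A M → HasRank M j → k ≤ j)

ZeroOK : ∀ {n} → Subset n → Maybe (Fin n) → Set
ZeroOK S nothing = ⊤
ZeroOK S (just i) = lookup S i ≡ true

-- row indices of the (n,r)-code matrix: an r-subset S and the position of
-- the zero in S (nothing = all entries of S equal 1); (r+1)·C(n,r) rows.
CodeRow : ℕ → ℕ → Set
CodeRow n r = Σ (Subset n) λ S → (∣ S ∣ ≡ r) × Σ (Maybe (Fin n)) (ZeroOK S)

codeEntry : ∀ {n} → Subset n → Maybe (Fin n) → Fin n → Entry
codeEntry S z j with lookup S j
... | false = ⋆
codeEntry S nothing j | true = 𝟙
codeEntry S (just i) j | true with i ≟ j
... | yes _ = 𝟘
... | no _ = 𝟙

codeMatrix : (n r : ℕ) → ZOSMatrix (CodeRow n r) n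
codeMatrix n r (S , _ , z , _) j = codeEntry S z j

-- A solution L of the (n, r)-code matrix A is a binary code of minimum distance greater than r: if
-- x, y ∈ L differ in at most r coordinates, choose an r-set S containing them; the r + 1 rows of A
-- belonging to S see x and y alike outside S, so the completion M annihilates x ⊕ y on these rows, and
-- they are nonsingular on S.  Hence for every family F of diameter at most r the translates x ⊕ F
-- (x ∈ L) are disjoint, and |L| · |F| ≤ 2 ^ n.  On the other hand, if h₁, …, hₙ ∈ GF(2) ^ t are r-wise
-- linearly independent, each row of A can be completed by a functional j ↦ ⟨x, h_j⟩, so mr(A) ≤ t.
-- A greedy choice of the h_j in blocks achieves t = O(r log (n / r)), while the words with at most one 1
-- in each of ⌊r / 2⌋ blocks form a family F with log |F| = Ω(r log (n / r)).  With the constants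
-- worked out, 2 ^ t ≤ |F| ^ 9, hence |L| ^ 9 · 2 ^ mr(A) ≤ 2 ^ (9 n): one may take ε = 1/9.

module Submission where

open import Defs
open import Algebra.Bundles using (CommutativeRing)
open import Data.Bool using (Bool; true; false; _∧_; _xor_; not; if_then_else_)
open import Data.Bool.Properties
  using (∧-zeroʳ; ∧-identityʳ; ∧-assoc; ∧-comm; ∧-distribˡ-xor; ∧-distribʳ-xor; ∧-conicalˡ; ∧-conicalʳ;
         xor-assoc; xor-comm; xor-identityʳ; xor-same; xor-∧-commutativeRing; ¬-not; not-injective)
  renaming (_≟_ to _≟ᵇ_)
open import Data.Empty using (⊥-elim)
open import Data.Fin using (Fin; zero; suc; _≟_)
import Data.Fin.Properties as Fin
open import Data.Fin.Subset using (Subset; ∣_∣)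
open import Data.Fin.Subset.Properties using (∣p∣≤n)
open import Data.List using (List; []; _∷_; length; map; cartesianProduct; cartesianProductWith)
import Data.List as List
open import Data.List.Membership.Propositional using (_∈_; _∉_)
open import Data.List.Membership.Propositional.Properties
  using (∈-lookup; ∈-map⁺; ∈-map⁻; ∈-++⁺ˡ; ∈-++⁺ʳ; ∈-concat⁻; ∈-cartesianProduct⁻;
         ∈-cartesianProductWith⁺; ∈-cartesianProductWith⁻)
open import Data.List.Properties using (length-map; length-++; length-removeAt′)
import Data.List.Relation.Binary.Sublist.Propositional as Sublist
open Sublist using ([]; _∷_; _∷ʳ_; ⊆-trans; minimum) renaming (_⊆_ to _⊑_)
open import Data.List.Relation.Unary.All using (All)
import Data.List.Relation.Unary.All as All
open import Data.List.Relation.Unary.All.Properties using (¬All⇒Any¬; ¬Any⇒All¬; ─⁺)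
open import Data.List.Relation.Unary.Any using (Any; here; there; index; satisfied; any?; _─_)
import Data.List.Relation.Unary.Any as Any
open import Data.List.Relation.Unary.Any.Properties using (lookup-index; lookup-result)
open import Data.List.Relation.Unary.Unique.Propositional using (Unique; []; _∷_)
import Data.List.Relation.Unary.Unique.Propositional.Properties as Unique
open import Data.Maybe using (just; nothing)
open import Data.Nat
  using (ℕ; zero; suc; _+_; _*_; _^_; _∸_; _≤_; _<_; z≤n; s≤s; _≤?_; _<?_; NonZero; >-nonZero; ⌊_/2⌋)
open import Data.Nat.DivMod using (_/_; _%_; m/n*n≤m; m≡m%n+[m/n]*n; m%n<n)
open import Data.Nat.Properties
  using (≤-refl; ≤-reflexive; ≤-trans; ≤-antisym; ≤-<-trans; <-≤-trans; <⇒≤; ≰⇒>; ≮⇒≥; <⇒≱; ≤-pred; n≮n;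
         m≤n⇒m≤1+n; 1+n≰n; n≤1+n; n<1+n; m≤m+n; m+[n∸m]≡n; +-suc; +-identityʳ; *-identityˡ; *-identityʳ; *-comm;
         +-mono-≤; +-monoˡ-≤; +-monoʳ-≤; +-monoˡ-<; *-mono-≤; *-monoˡ-≤; *-monoʳ-≤;
         m^n>0; ^-monoˡ-≤; ^-monoʳ-≤; ^-monoʳ-<; ^-*-assoc; ^-distribˡ-+-*)
import Data.Nat.Properties
open import Data.Nat.Tactic.RingSolver using (solve-∀)
open import Data.Product using (Σ; _×_; _,_; proj₁; proj₂)
import Data.Product as Product
open import Data.Sum using (_⊎_; inj₁; inj₂; [_,_]′)
import Data.Sum as Sum
open import Data.Vec using (Vec; []; _∷_; _++_; head; tail; lookup)
open import Data.Vec.Properties using (≡-dec; tabulate∘lookup; tabulate-cong; ∷-injectiveʳ; ++-injective; ++-injectiveˡ)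
open import Function using (_∘_; case_of_)
open import Relation.Binary.PropositionalEquality
open import Relation.Nullary using (¬_; Dec; yes; no; does)
open import Relation.Nullary.Decidable
  using (toSum; dec-true; dec-false; _×-dec_; decidable-stable; ¬¬-excluded-middle)

open import Algebra.Properties.CommutativeSemigroup
  (CommutativeRing.+-commutativeSemigroup xor-∧-commutativeRing)
  using () renaming (interchange to xor-interchange)

-- Linear algebra over GF(2)

true≢false : true ≢ false
true≢false ()

xor-cancelʳ : ∀ a b → (a xor b) xor b ≡ a
xor-cancelʳ a b = trans (xor-assoc a b b) (trans (cong (a xor_) (xor-same b)) (xor-identityʳ a))

xor-cancelˡ : ∀ a b → a xor (b xor a) ≡ b
xor-cancelˡ a b = trans (xor-comm a (b xor a)) (xor-cancelʳ b a)

xor≡false⇒≡ : ∀ {a b} → a xor b ≡ false → a ≡ b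
xor≡false⇒≡ {a} {b} eq = trans (sym (xor-cancelʳ a b)) (cong (_xor b) eq)

δ : ∀ {n} → Fin n → Fin n → Bool
δ i j = does (i ≟ j)

δ-refl : ∀ {n} (i : Fin n) → δ i i ≡ true
δ-refl i = dec-true (i ≟ i) refl

δ-≢ : ∀ {n} {i j : Fin n} → i ≢ j → δ i j ≡ false
δ-≢ {i = i} {j} = dec-false (i ≟ j)

δ≡true⇒≡ : ∀ {n} {i j : Fin n} → δ i j ≡ true → i ≡ j
δ≡true⇒≡ {i = i} {j} eq with i ≟ j
... | yes i≡j = i≡j
... | no _ = ⊥-elim (true≢false (sym eq))

sumF-cong : ∀ {n} {f g : Fin n → Bool} → (∀ j → f j ≡ g j) → sumF f ≡ sumF g
sumF-cong {zero} eq = refl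
sumF-cong {suc n} eq = cong₂ _xor_ (eq zero) (sumF-cong (eq ∘ suc))

sumF-false : ∀ {n} {f : Fin n → Bool} → (∀ j → f j ≡ false) → sumF f ≡ false
sumF-false {zero} eq = refl
sumF-false {suc n} eq rewrite eq zero = sumF-false (eq ∘ suc)

sumF-xor : ∀ {n} (f g : Fin n → Bool) → sumF (λ j → f j xor g j) ≡ sumF f xor sumF g
sumF-xor {zero} f g = refl
sumF-xor {suc n} f g =
  trans (cong ((f zero xor g zero) xor_) (sumF-xor (f ∘ suc) (g ∘ suc)))
        (xor-interchange (f zero) (g zero) _ _)

sumF-δ : ∀ {n} (i : Fin n) (f : Fin n → Bool) → sumF (λ j → δ i j ∧ f j) ≡ f i
sumF-δ zero f =
  trans (cong (f zero xor_) (sumF-false {f = λ j → δ zero (suc j) ∧ f (suc j)} (λ _ → refl)))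
        (xor-identityʳ (f zero))
sumF-δ (suc i) f = sumF-δ i (f ∘ suc)

-- Vectors over GF(2); the operations recurse on the length through head and tail, so that
-- they compute on vectors that are not syntactically of the form x ∷ u.
zeros : ∀ {t} → Vec Bool t
zeros {zero} = []
zeros {suc t} = false ∷ zeros

infixl 6 _⊕_
infixr 7 _·_

_⊕_ : ∀ {t} → Vec Bool t → Vec Bool t → Vec Bool t
_⊕_ {zero} u v = []
_⊕_ {suc t} u v = (head u xor head v) ∷ (tail u ⊕ tail v)

_·_ : ∀ {t} → Bool → Vec Bool t → Vec Bool t
_·_ {zero} a u = []
_·_ {suc t} a u = (a ∧ head u) ∷ (a · tail u)

dot : ∀ {t} → Vec Bool t → Vec Bool t → Bool
dot {zero} u v = false
dot {suc t} u v = (head u ∧ head v) xor dot (tail u) (tail v)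

lincomb : ∀ {k t} → (Fin k → Bool) → (Fin k → Vec Bool t) → Vec Bool t
lincomb {zero} c u = zeros
lincomb {suc k} c u = c zero · u zero ⊕ lincomb (c ∘ suc) (u ∘ suc)

Vec0-unique : ∀ {A : Set} (u : Vec A 0) → u ≡ []
Vec0-unique [] = refl

⊕-identityʳ : ∀ {t} (u : Vec Bool t) → u ⊕ zeros ≡ u
⊕-identityʳ [] = refl
⊕-identityʳ (x ∷ u) = cong₂ _∷_ (xor-identityʳ x) (⊕-identityʳ u)

⊕-identityˡ : ∀ {t} (u : Vec Bool t) → zeros ⊕ u ≡ u
⊕-identityˡ [] = refl
⊕-identityˡ (x ∷ u) = cong (x ∷_) (⊕-identityˡ u)

⊕-self : ∀ {t} (u : Vec Bool t) → u ⊕ u ≡ zeros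
⊕-self {zero} u = refl
⊕-self {suc t} u = cong₂ _∷_ (xor-same (head u)) (⊕-self (tail u))

⊕-comm : ∀ {t} (u v : Vec Bool t) → u ⊕ v ≡ v ⊕ u
⊕-comm {zero} u v = refl
⊕-comm {suc t} u v = cong₂ _∷_ (xor-comm (head u) (head v)) (⊕-comm (tail u) (tail v))

⊕-assoc : ∀ {t} (u v w : Vec Bool t) → (u ⊕ v) ⊕ w ≡ u ⊕ (v ⊕ w)
⊕-assoc {zero} u v w = refl
⊕-assoc {suc t} u v w =
  cong₂ _∷_ (xor-assoc (head u) (head v) (head w)) (⊕-assoc (tail u) (tail v) (tail w))

⊕-interchange : ∀ {t} (u v w z : Vec Bool t) → (u ⊕ v) ⊕ (w ⊕ z) ≡ (u ⊕ w) ⊕ (v ⊕ z)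
⊕-interchange {zero} u v w z = refl
⊕-interchange {suc t} u v w z =
  cong₂ _∷_ (xor-interchange (head u) (head v) (head w) (head z))
            (⊕-interchange (tail u) (tail v) (tail w) (tail z))

⊕≡zeros⇒≡ : ∀ {t} {u v : Vec Bool t} → u ⊕ v ≡ zeros → u ≡ v
⊕≡zeros⇒≡ {u = u} {v} eq = begin
  u               ≡⟨ sym (⊕-identityʳ u) ⟩
  u ⊕ zeros       ≡⟨ cong (u ⊕_) (sym (⊕-self v)) ⟩
  u ⊕ (v ⊕ v)     ≡⟨ sym (⊕-assoc u v v) ⟩
  (u ⊕ v) ⊕ v     ≡⟨ cong (_⊕ v) eq ⟩
  zeros ⊕ v       ≡⟨ ⊕-identityˡ v ⟩
  v               ∎
  where open ≡-Reasoning

·-zeroˡ : ∀ {t} (u : Vec Bool t) → false · u ≡ zeros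
·-zeroˡ {zero} u = refl
·-zeroˡ {suc t} u = cong (false ∷_) (·-zeroˡ (tail u))

·-identityˡ : ∀ {t} (u : Vec Bool t) → true · u ≡ u
·-identityˡ [] = refl
·-identityˡ (x ∷ u) = cong (x ∷_) (·-identityˡ u)

·-distribˡ-⊕ : ∀ {t} a (u v : Vec Bool t) → a · (u ⊕ v) ≡ a · u ⊕ a · v
·-distribˡ-⊕ {zero} a u v = refl
·-distribˡ-⊕ {suc t} a u v = cong₂ _∷_ (∧-distribˡ-xor a (head u) (head v)) (·-distribˡ-⊕ a (tail u) (tail v))

·-distribʳ-xor : ∀ {t} a b (u : Vec Bool t) → (a xor b) · u ≡ a · u ⊕ b · u
·-distribʳ-xor {zero} a b u = refl
·-distribʳ-xor {suc t} a b u = cong₂ _∷_ (∧-distribʳ-xor (head u) a b) (·-distribʳ-xor a b (tail u))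

·-assoc : ∀ {t} a b (u : Vec Bool t) → (a ∧ b) · u ≡ a · (b · u)
·-assoc {zero} a b u = refl
·-assoc {suc t} a b u = cong₂ _∷_ (∧-assoc a b (head u)) (·-assoc a b (tail u))



lincomb-xor : ∀ {k t} (c d : Fin k → Bool) (u : Fin k → Vec Bool t) →
              lincomb (λ s → c s xor d s) u ≡ lincomb c u ⊕ lincomb d u
lincomb-xor {zero} c d u = sym (⊕-self zeros)
lincomb-xor {suc k} c d u =
  trans (cong₂ _⊕_ (·-distribʳ-xor (c zero) (d zero) (u zero)) (lincomb-xor (c ∘ suc) (d ∘ suc) (u ∘ suc)))
        (⊕-interchange _ _ _ _)

lincomb-⊕ : ∀ {k t} (c : Fin k → Bool) (u v : Fin k → Vec Bool t) →
            lincomb c (λ s → u s ⊕ v s) ≡ lincomb c u ⊕ lincomb c v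
lincomb-⊕ {zero} c u v = sym (⊕-self zeros)
lincomb-⊕ {suc k} c u v =
  trans (cong₂ _⊕_ (·-distribˡ-⊕ (c zero) (u zero) (v zero)) (lincomb-⊕ (c ∘ suc) (u ∘ suc) (v ∘ suc)))
        (⊕-interchange _ _ _ _)

lincomb-· : ∀ {k t} (c g : Fin k → Bool) (w : Vec Bool t) →
            lincomb c (λ s → g s · w) ≡ sumF (λ s → c s ∧ g s) · w
lincomb-· {zero} c g w = sym (·-zeroˡ w)
lincomb-· {suc k} c g w =
  trans (cong₂ _⊕_ (sym (·-assoc (c zero) (g zero) w)) (lincomb-· (c ∘ suc) (g ∘ suc) w))
        (sym (·-distribʳ-xor (c zero ∧ g zero) _ w))

lincomb-δ : ∀ {k t} (i : Fin k) a (u : Fin k → Vec Bool t) → lincomb (λ s → δ i s ∧ a) u ≡ a · u i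
lincomb-δ zero a u = begin
  a · u zero ⊕ lincomb (λ _ → false) (u ∘ suc)   ≡⟨ cong (a · u zero ⊕_) (lincomb-false (u ∘ suc)) ⟩
  a · u zero ⊕ zeros                             ≡⟨ ⊕-identityʳ _ ⟩
  a · u zero                                      ∎
  where
  open ≡-Reasoning
  lincomb-false : ∀ {k} (v : Fin k → Vec Bool _) → lincomb (λ _ → false) v ≡ zeros
  lincomb-false {zero} v = refl
  lincomb-false {suc k} v = trans (cong₂ _⊕_ (·-zeroˡ (v zero)) (lincomb-false (v ∘ suc))) (⊕-self zeros)
lincomb-δ (suc i) a u = begin
  false · u zero ⊕ lincomb (λ s → δ i s ∧ a) (u ∘ suc) ≡⟨ cong₂ _⊕_ (·-zeroˡ (u zero)) (lincomb-δ i a (u ∘ suc)) ⟩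
  zeros ⊕ a · u (suc i)                              ≡⟨ ⊕-identityˡ _ ⟩
  a · u (suc i)                                      ∎
  where open ≡-Reasoning

lincomb-head∷tail : ∀ {k t} (c : Fin k → Bool) (u : Fin k → Vec Bool (suc t)) →
                    lincomb c u ≡ sumF (λ s → c s ∧ head (u s)) ∷ lincomb c (tail ∘ u)
lincomb-head∷tail {zero} c u = refl
lincomb-head∷tail {suc k} c u =
  cong₂ (λ a v → ((c zero ∧ head (u zero)) xor a) ∷ (c zero · tail (u zero) ⊕ v))
        (cong head (lincomb-head∷tail (c ∘ suc) (u ∘ suc)))
        (cong tail (lincomb-head∷tail (c ∘ suc) (u ∘ suc)))

dot-⊕ʳ : ∀ {t} (x u v : Vec Bool t) → dot x (u ⊕ v) ≡ dot x u xor dot x v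
dot-⊕ʳ {zero} x u v = refl
dot-⊕ʳ {suc t} x u v =
  trans (cong₂ _xor_ (∧-distribˡ-xor (head x) (head u) (head v)) (dot-⊕ʳ (tail x) (tail u) (tail v)))
        (xor-interchange (head x ∧ head u) (head x ∧ head v) (dot (tail x) (tail u)) (dot (tail x) (tail v)))

dot-·ʳ : ∀ {t} (x : Vec Bool t) a (u : Vec Bool t) → dot x (a · u) ≡ a ∧ dot x u
dot-·ʳ {zero} x a u = sym (∧-zeroʳ a)
dot-·ʳ {suc t} x a u =
  trans (cong₂ _xor_ (∧-swap (head x) a (head u)) (dot-·ʳ (tail x) a (tail u)))
        (sym (∧-distribˡ-xor a _ _))
  where
  ∧-swap : ∀ p q r → p ∧ (q ∧ r) ≡ q ∧ (p ∧ r)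
  ∧-swap p q r = trans (sym (∧-assoc p q r)) (trans (cong (_∧ r) (∧-comm p q)) (∧-assoc q p r))

dot-zerosˡ : ∀ {t} (w : Vec Bool t) → dot zeros w ≡ false
dot-zerosˡ {zero} w = refl
dot-zerosˡ {suc t} w = dot-zerosˡ (tail w)

dot-lincombˡ : ∀ {k t} (c : Fin k → Bool) (u : Fin k → Vec Bool t) (w : Vec Bool t) →
               dot (lincomb c u) w ≡ sumF (λ s → c s ∧ dot (u s) w)
dot-lincombˡ {zero} c u w = dot-zerosˡ w
dot-lincombˡ {suc k} c u w =
  trans (dot-⊕ˡ (c zero · u zero) _ w)
        (cong₂ _xor_ (dot-·ˡ (c zero) (u zero) w) (dot-lincombˡ (c ∘ suc) (u ∘ suc) w))
  where
  dot-⊕ˡ : ∀ {t} (u v w : Vec Bool t) → dot (u ⊕ v) w ≡ dot u w xor dot v w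
  dot-⊕ˡ {zero} u v w = refl
  dot-⊕ˡ {suc t} u v w =
    trans (cong₂ _xor_ (∧-distribʳ-xor (head w) (head u) (head v)) (dot-⊕ˡ (tail u) (tail v) (tail w)))
          (xor-interchange (head u ∧ head w) (head v ∧ head w) (dot (tail u) (tail w)) (dot (tail v) (tail w)))
  dot-·ˡ : ∀ {t} a (u w : Vec Bool t) → dot (a · u) w ≡ a ∧ dot u w
  dot-·ˡ {zero} a u w = sym (∧-zeroʳ a)
  dot-·ˡ {suc t} a u w =
    trans (cong₂ _xor_ (∧-assoc a (head u) (head w)) (dot-·ˡ a (tail u) (tail w)))
          (sym (∧-distribˡ-xor a _ _))

count : ∀ {n} → (Fin n → Bool) → ℕ
count {zero} c = 0
count {suc n} c = if c zero then suc (count (c ∘ suc)) else count (c ∘ suc)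

count-cong : ∀ {n} {c d : Fin n → Bool} → (∀ j → c j ≡ d j) → count c ≡ count d
count-cong {zero} eq = refl
count-cong {suc n} {c} {d} eq rewrite eq zero | count-cong (eq ∘ suc) = refl

count-false : ∀ {n} {c : Fin n → Bool} → (∀ j → c j ≡ false) → count c ≡ 0
count-false {zero} eq = refl
count-false {suc n} eq rewrite eq zero = count-false (eq ∘ suc)

count-true : ∀ n → count {n} (λ _ → true) ≡ n
count-true zero = refl
count-true (suc n) = cong suc (count-true n)

count≡0⇒false : ∀ {n} (c : Fin n → Bool) → count c ≡ 0 → ∀ j → c j ≡ false
count≡0⇒false {suc n} c eq j with c zero in c₀
count≡0⇒false {suc n} c () j | true
count≡0⇒false {suc n} c eq zero | false = c₀
count≡0⇒false {suc n} c eq (suc j) | false = count≡0⇒false (c ∘ suc) eq j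

count-lookup : ∀ {n} (S : Subset n) → count (lookup S) ≡ ∣ S ∣
count-lookup [] = refl
count-lookup (true ∷ S) = cong suc (count-lookup S)
count-lookup (false ∷ S) = count-lookup S

infix 4 _⊆_

_⊆_ : ∀ {n} → (Fin n → Bool) → (Fin n → Bool) → Set
c ⊆ S = ∀ j → c j ≡ true → S j ≡ true

⊆-outside : ∀ {n} {c S : Fin n → Bool} → c ⊆ S → ∀ {j} → S j ≡ false → c j ≡ false
⊆-outside c⊆S {j} S-j = ¬-not (λ c-j → true≢false (trans (sym (c⊆S j c-j)) S-j))

count-mono : ∀ {n} {c S : Fin n → Bool} → c ⊆ S → count c ≤ count S
count-mono {zero} c⊆S = z≤n
count-mono {suc n} {c} {S} c⊆S with c zero in c₀ | S zero in S₀
... | true | true = s≤s (count-mono (c⊆S ∘ suc))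
... | true | false = ⊥-elim (true≢false (trans (sym (c⊆S zero c₀)) S₀))
... | false | true = m≤n⇒m≤1+n (count-mono (c⊆S ∘ suc))
... | false | false = count-mono (c⊆S ∘ suc)

infixl 6 _∖_

_∖_ : ∀ {n} → (Fin n → Bool) → Fin n → Fin n → Bool
(S ∖ i) j = S j ∧ not (δ i j)

count-∖ : ∀ {n} (S : Fin n → Bool) {i} → S i ≡ true → count S ≡ suc (count (S ∖ i))
count-∖ {suc n} S {zero} S₀ rewrite S₀ = cong suc (count-cong (λ j → sym (∧-identityʳ (S (suc j)))))
count-∖ {suc n} S {suc i} Sᵢ with S zero
... | true = cong suc (count-∖ (S ∘ suc) Sᵢ)
... | false = count-∖ (S ∘ suc) Sᵢ

-- Gaussian elimination

Nontrivial : ∀ {n} → (Fin n → Bool) → Set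
Nontrivial {n} c = Σ (Fin n) λ j → c j ≡ true

Dependent : ∀ {n t} → (Fin n → Bool) → (Fin n → Vec Bool t) → Set
Dependent {n} S h = Σ (Fin n → Bool) λ c → c ⊆ S × Nontrivial c × lincomb c h ≡ zeros

Solvable : ∀ {n t} → (Fin n → Bool) → (Fin n → Vec Bool t) → Set
Solvable {n} {t} S h = ∀ (b : Fin n → Bool) → Σ (Vec Bool t) λ x → ∀ j → S j ≡ true → dot x (h j) ≡ b j

eliminate : ∀ {n t} → Fin n → (Fin n → Vec Bool (suc t)) → Fin n → Vec Bool t
eliminate j₀ h j = tail (h j) ⊕ head (h j) · tail (h j₀)

back-substitute : ∀ h b b₀ d₀ d → d xor (h ∧ d₀) ≡ b xor (h ∧ b₀) → ((b₀ xor d₀) ∧ h) xor d ≡ b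
back-substitute h b b₀ d₀ d eq = begin
  ((b₀ xor d₀) ∧ h) xor d             ≡⟨ cong (_xor d) (∧-distribʳ-xor h b₀ d₀) ⟩
  ((b₀ ∧ h) xor (d₀ ∧ h)) xor d       ≡⟨ cong₂ (λ x y → (x xor y) xor d) (∧-comm b₀ h) (∧-comm d₀ h) ⟩
  ((h ∧ b₀) xor (h ∧ d₀)) xor d       ≡⟨ xor-assoc (h ∧ b₀) (h ∧ d₀) d ⟩
  (h ∧ b₀) xor ((h ∧ d₀) xor d)       ≡⟨ cong ((h ∧ b₀) xor_) (trans (xor-comm (h ∧ d₀) d) eq) ⟩
  (h ∧ b₀) xor (b xor (h ∧ b₀))       ≡⟨ xor-cancelˡ (h ∧ b₀) b ⟩
  b                                    ∎
  where open ≡-Reasoning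

module Pivot {n t} (S : Fin n → Bool) (h : Fin n → Vec Bool (suc t)) {j₀ : Fin n}
             (S-j₀ : S j₀ ≡ true) (pivot : head (h j₀) ≡ true) where

  open ≡-Reasoning

  dependent : Dependent (S ∖ j₀) (eliminate j₀ h) → Dependent S h
  dependent (c′ , c′⊆ , (j₁ , c′-j₁) , c′-dependent) = c , c⊆S , (j₁ , c-j₁) , c-dependent
    where
    a : Bool
    a = sumF (λ s → c′ s ∧ head (h s))
    c : Fin n → Bool
    c s = c′ s xor (δ j₀ s ∧ a)
    c≡c′ : ∀ {s} → δ j₀ s ≡ false → c s ≡ c′ s
    c≡c′ {s} δ≡false = trans (cong (λ z → c′ s xor (z ∧ a)) δ≡false) (xor-identityʳ (c′ s))
    c⊆S : c ⊆ S
    c⊆S s c-s with j₀ ≟ s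
    ... | yes refl = S-j₀
    ... | no _ = ∧-conicalˡ _ _ (c′⊆ s (trans (sym (xor-identityʳ (c′ s))) c-s))
    c-j₁ : c j₁ ≡ true
    c-j₁ = trans (c≡c′ (not-injective (∧-conicalʳ _ _ (c′⊆ j₁ c′-j₁)))) c′-j₁
    tails : lincomb c′ (tail ∘ h) ≡ a · tail (h j₀)
    tails = ⊕≡zeros⇒≡ (begin
      lincomb c′ (tail ∘ h) ⊕ a · tail (h j₀)
        ≡⟨ cong (lincomb c′ (tail ∘ h) ⊕_) (sym (lincomb-· c′ (head ∘ h) (tail (h j₀)))) ⟩
      lincomb c′ (tail ∘ h) ⊕ lincomb c′ (λ s → head (h s) · tail (h j₀))
        ≡⟨ sym (lincomb-⊕ c′ (tail ∘ h) (λ s → head (h s) · tail (h j₀))) ⟩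
      lincomb c′ (eliminate j₀ h)
        ≡⟨ c′-dependent ⟩
      zeros ∎)
    c-dependent : lincomb c h ≡ zeros
    c-dependent = begin
      lincomb c h
        ≡⟨ lincomb-xor c′ (λ s → δ j₀ s ∧ a) h ⟩
      lincomb c′ h ⊕ lincomb (λ s → δ j₀ s ∧ a) h
        ≡⟨ cong₂ _⊕_ (lincomb-head∷tail c′ h) (lincomb-δ j₀ a h) ⟩
      (a ∷ lincomb c′ (tail ∘ h)) ⊕ ((a ∧ head (h j₀)) ∷ a · tail (h j₀))
        ≡⟨ cong₂ (λ u b → (a ∷ u) ⊕ (b ∷ a · tail (h j₀))) tails (trans (cong (a ∧_) pivot) (∧-identityʳ a)) ⟩
      (a ∷ a · tail (h j₀)) ⊕ (a ∷ a · tail (h j₀))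
        ≡⟨ ⊕-self (a ∷ a · tail (h j₀)) ⟩
      zeros ∎

  solvable : Solvable (S ∖ j₀) (eliminate j₀ h) → Solvable S h
  solvable solve b = x₀ ∷ x′ , solves
    where
    b′ : Fin n → Bool
    b′ j = b j xor (head (h j) ∧ b j₀)
    x′ : Vec Bool t
    x′ = proj₁ (solve b′)
    x₀ : Bool
    x₀ = b j₀ xor dot x′ (tail (h j₀))
    solves : ∀ j → S j ≡ true → dot (x₀ ∷ x′) (h j) ≡ b j
    solves j S-j with j₀ ≟ j
    ... | yes refl = begin
      (x₀ ∧ head (h j₀)) xor dot x′ (tail (h j₀)) ≡⟨ cong (λ z → z xor dot x′ (tail (h j₀))) (trans (cong (x₀ ∧_) pivot) (∧-identityʳ x₀)) ⟩
      x₀ xor dot x′ (tail (h j₀))                  ≡⟨ xor-cancelʳ (b j₀) (dot x′ (tail (h j₀))) ⟩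
      b j₀                                          ∎
    ... | no j₀≢j = back-substitute (head (h j)) (b j) (b j₀) (dot x′ (tail (h j₀))) (dot x′ (tail (h j))) (begin
      dot x′ (tail (h j)) xor (head (h j) ∧ dot x′ (tail (h j₀)))
        ≡⟨ cong (dot x′ (tail (h j)) xor_) (sym (dot-·ʳ x′ (head (h j)) (tail (h j₀)))) ⟩
      dot x′ (tail (h j)) xor dot x′ (head (h j) · tail (h j₀))
        ≡⟨ sym (dot-⊕ʳ x′ (tail (h j)) (head (h j) · tail (h j₀))) ⟩
      dot x′ (eliminate j₀ h j)
        ≡⟨ proj₂ (solve b′) j (trans (cong (λ z → S j ∧ not z) (δ-≢ j₀≢j)) (trans (∧-identityʳ (S j)) S-j)) ⟩
      b′ j ∎)

dependent-tail : ∀ {n t} {S : Fin n → Bool} {h : Fin n → Vec Bool (suc t)} →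
                 (∀ j → S j ≡ true → head (h j) ≡ false) → Dependent S (tail ∘ h) → Dependent S h
dependent-tail {h = h} heads≡false (c , c⊆S , nontrivial , c-dependent) =
  c , c⊆S , nontrivial ,
  trans (lincomb-head∷tail c h) (cong₂ _∷_ (sumF-false c∧head≡false) c-dependent)
  where
  c∧head≡false : ∀ s → c s ∧ head (h s) ≡ false
  c∧head≡false s with c s in c-s
  ... | true = heads≡false s (c⊆S s c-s)
  ... | false = refl

solvable-tail : ∀ {n t} {S : Fin n → Bool} {h : Fin n → Vec Bool (suc t)} →
                Solvable S (tail ∘ h) → Solvable S h
solvable-tail solve b = false ∷ proj₁ (solve b) , proj₂ (solve b)

-- Gaussian elimination on the first coordinate, with a pivot chosen in S.
dependent-or-solvable : ∀ {n} t (S : Fin n → Bool) (h : Fin n → Vec Bool t) →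
                        Dependent S h ⊎ (count S ≤ t × Solvable S h)
dependent-or-solvable zero S h with Fin.any? (λ j → S j ≟ᵇ true)
... | yes (j , S-j) =
  inj₁ (δ j , (λ s δ-js → subst (λ z → S z ≡ true) (δ≡true⇒≡ δ-js) S-j) , (j , δ-refl j) , Vec0-unique _)
... | no ∄j = inj₂ (≤-reflexive (count-false (λ j → ¬-not (λ S-j → ∄j (j , S-j)))) ,
                    λ b → [] , λ j S-j → ⊥-elim (∄j (j , S-j)))
dependent-or-solvable (suc t) S h with Fin.any? (λ j → (S j ≟ᵇ true) ×-dec (head (h j) ≟ᵇ true))
... | yes (j₀ , S-j₀ , pivot) =
  Sum.map (Pivot.dependent S h S-j₀ pivot)
          (Product.map (λ ≤t → ≤-trans (≤-reflexive (count-∖ S S-j₀)) (s≤s ≤t)) (Pivot.solvable S h S-j₀ pivot))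
          (dependent-or-solvable t (S ∖ j₀) (eliminate j₀ h))
... | no ∄pivot =
  Sum.map (dependent-tail {h = h} (λ j S-j → ¬-not (λ head≡true → ∄pivot (j , S-j , head≡true))))
          (Product.map m≤n⇒m≤1+n (solvable-tail {h = h}))
          (dependent-or-solvable t S (tail ∘ h))

-- An upper bound on the minimum rank

¬¬-last : ∀ (P : ℕ → Set) t → P 0 → ¬ P (suc t) → ¬ ¬ (Σ ℕ λ j → j ≤ t × P j × ¬ P (suc j))
¬¬-last P zero p₀ ¬p k = k (0 , z≤n , p₀ , ¬p)
¬¬-last P (suc t) p₀ ¬p k = ¬¬-excluded-middle λ
  { (yes p) → k (suc t , ≤-refl , p , ¬p)
  ; (no ¬p′) → ¬¬-last P t p₀ ¬p′ (λ (j , j≤t , pj , ¬pj₊₁) → k (j , m≤n⇒m≤1+n j≤t , pj , ¬pj₊₁))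
  }

-- The rank of M need not be computable, but k ≤ t is decidable, so a classical search suffices.
minRank≤ : ∀ {I n} {A : ZOSMatrix I n} {M : BMatrix I n} {k t} →
           IsMinRank A k → IsCompletion A M → ¬ HasIndepRows M (suc t) → k ≤ t
minRank≤ {M = M} {k} {t} (_ , minimal) completion ¬indep = decidable-stable (k ≤? t) λ k≰t →
  ¬¬-last (HasIndepRows M) t ((λ ()) , λ _ _ ()) ¬indep
    (λ (j , j≤t , indep , ¬indep₊₁) → k≰t (≤-trans (minimal M j completion (indep , ¬indep₊₁)) j≤t))

factored-rank≤ : ∀ {I n t} (x : I → Vec Bool t) (h : Fin n → Vec Bool t) →
                 ¬ HasIndepRows (λ i j → dot (x i) (h j)) (suc t)
factored-rank≤ {t = t} x h (f , independent) with dependent-or-solvable t (λ _ → true) (x ∘ f)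
... | inj₂ (t+1≤t , _) = 1+n≰n (subst (_≤ t) (count-true (suc t)) t+1≤t)
... | inj₁ (c , _ , (s , c-s) , c-dependent) = true≢false (trans (sym c-s) (independent c vanishes s))
  where
  vanishes : ∀ j → sumF (λ s → c s ∧ dot (x (f s)) (h j)) ≡ false
  vanishes j = trans (sym (dot-lincombˡ c (x ∘ f) (h j)))
                     (trans (cong (λ z → dot z (h j)) c-dependent) (dot-zerosˡ (h j)))

-- ⋆ is sent to an arbitrary bit; only the bits of 𝟘 and 𝟙 entries are ever used.
entryBit : Entry → Bool
entryBit 𝟘 = false
entryBit 𝟙 = true
entryBit ⋆ = false

fits-entryBit : ∀ {e b} → e ≡ ⋆ ⊎ b ≡ entryBit e → Fits e b
fits-entryBit {𝟘} (inj₂ b≡) = b≡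
fits-entryBit {𝟙} (inj₂ b≡) = b≡
fits-entryBit {⋆} _ = _

entryBit-fits : ∀ {e b} → Fits e b → e ≢ ⋆ → b ≡ entryBit e
entryBit-fits {𝟘} fits _ = fits
entryBit-fits {𝟙} fits _ = fits
entryBit-fits {⋆} _ e≢⋆ = ⊥-elim (e≢⋆ refl)

codeEntry-⋆⊎∈ : ∀ {n} (S : Subset n) z j → codeEntry S z j ≡ ⋆ ⊎ lookup S j ≡ true
codeEntry-⋆⊎∈ S z j with lookup S j
... | false = inj₁ refl
... | true = inj₂ refl

codeEntry-∈ : ∀ {n} (S : Subset n) z {j} → lookup S j ≡ true → codeEntry S z j ≢ ⋆
codeEntry-∈ S nothing {j} S-j rewrite S-j = λ ()
codeEntry-∈ S (just i) {j} S-j rewrite S-j with i ≟ j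
... | yes _ = λ ()
... | no _ = λ ()

RWiseIndependent : ∀ {n t} → ℕ → (Fin n → Vec Bool t) → Set
RWiseIndependent {n} r h = ∀ (c : Fin n → Bool) → count c ≤ r → lincomb c h ≡ zeros → ∀ j → c j ≡ false

-- Each row of the code matrix prescribes bits only on an r-set S, where the columns h j are independent,
-- so it is completed by a functional j ↦ ⟨x, h j⟩ on GF(2)^t.
codeMatrix-minRank≤ : ∀ {n r t} (h : Fin n → Vec Bool t) → RWiseIndependent r h →
                      ∀ {k} → IsMinRank (codeMatrix n r) k → k ≤ t
codeMatrix-minRank≤ {n} {r} {t} h independent minRank = minRank≤ minRank completion (factored-rank≤ x h)
  where
  solvable : (S : Subset n) → ∣ S ∣ ≡ r → Solvable (lookup S) h
  solvable S ∣S∣≡r with dependent-or-solvable t (lookup S) h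
  ... | inj₂ (_ , solve) = solve
  ... | inj₁ (c , c⊆S , (j , c-j) , c-dependent) =
    ⊥-elim (true≢false (trans (sym c-j) (independent c c≤r c-dependent j)))
    where
    c≤r : count c ≤ r
    c≤r = ≤-trans (count-mono c⊆S) (≤-reflexive (trans (count-lookup S) ∣S∣≡r))
  x : CodeRow n r → Vec Bool t
  x (S , ∣S∣≡r , z , _) = proj₁ (solvable S ∣S∣≡r (entryBit ∘ codeEntry S z))
  completion : IsCompletion (codeMatrix n r) (λ ρ j → dot (x ρ) (h j))
  completion (S , ∣S∣≡r , z , _) j =
    fits-entryBit (Sum.map₂ (proj₂ (solvable S ∣S∣≡r (entryBit ∘ codeEntry S z)) j) (codeEntry-⋆⊎∈ S z j))

-- Solutions are codes of minimum distance greater than r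

lookup-⊕ : ∀ {n} (x y : Vec Bool n) j → lookup (x ⊕ y) j ≡ lookup x j xor lookup y j
lookup-⊕ (a ∷ x) (b ∷ y) zero = refl
lookup-⊕ (a ∷ x) (b ∷ y) (suc j) = lookup-⊕ x y j

lookup-injective : ∀ {n} {x y : Vec Bool n} → (∀ j → lookup x j ≡ lookup y j) → x ≡ y
lookup-injective {x = x} {y} eq = trans (sym (tabulate∘lookup x)) (trans (tabulate-cong eq) (tabulate∘lookup y))

mulVec-⊕ : ∀ {I n} (M : BMatrix I n) (x y : Vec Bool n) i → mulVec M (x ⊕ y) i ≡ mulVec M x i xor mulVec M y i
mulVec-⊕ M x y i =
  trans (sumF-cong (λ j → trans (cong (M i j ∧_) (lookup-⊕ x y j)) (∧-distribˡ-xor (M i j) _ _)))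
        (sumF-xor (λ j → M i j ∧ lookup x j) (λ j → M i j ∧ lookup y j))

extend-⊆ : ∀ {n} (d : Subset n) {r} → ∣ d ∣ ≤ r → r ≤ n →
           Σ (Subset n) λ S → ∣ S ∣ ≡ r × lookup d ⊆ lookup S
extend-⊆ [] {zero} _ _ = [] , refl , λ ()
extend-⊆ (true ∷ d) {suc r} (s≤s d≤r) (s≤s r≤n) with extend-⊆ d d≤r r≤n
... | S , ∣S∣≡r , d⊆S = true ∷ S , cong suc ∣S∣≡r , λ { zero _ → refl ; (suc j) → d⊆S j }
extend-⊆ {suc n} (false ∷ d) {r} d≤r r≤1+n with r ≤? n
... | yes r≤n with extend-⊆ d d≤r r≤n
...   | S , ∣S∣≡r , d⊆S = false ∷ S , ∣S∣≡r , λ { zero () ; (suc j) → d⊆S j }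
extend-⊆ {suc n} (false ∷ d) {r} d≤r r≤1+n | no r≰n with extend-⊆ d (∣p∣≤n d) ≤-refl
... | S , ∣S∣≡n , d⊆S =
  true ∷ S , trans (cong suc ∣S∣≡n) (sym (≤-antisym r≤1+n (≰⇒> r≰n))) , λ { zero _ → refl ; (suc j) → d⊆S j }

entryBit-nothing : ∀ {n} (S : Subset n) j → entryBit (codeEntry S nothing j) ≡ lookup S j
entryBit-nothing S j with lookup S j
... | true = refl
... | false = refl

entryBit-just : ∀ {n} (S : Subset n) i j → entryBit (codeEntry S (just i) j) ≡ lookup S j ∧ not (δ i j)
entryBit-just S i j with lookup S j
... | false = refl
... | true with i ≟ j
...   | yes _ = refl
...   | no _ = refl

∧-xor-∧-not : ∀ a d e → (a ∧ d) xor ((a ∧ not e) ∧ d) ≡ e ∧ (a ∧ d)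
∧-xor-∧-not false d e = sym (∧-zeroʳ e)
∧-xor-∧-not true d true = xor-identityʳ d
∧-xor-∧-not true d false = xor-same d

-- Row (S, nothing) sums d over S and row (S, just i) sums it over S ∖ i; the two sums differ by d i.
codeRows-nonsingular : ∀ {n} (S : Subset n) (d : Fin n → Bool) →
  (∀ z → ZeroOK S z → sumF (λ j → entryBit (codeEntry S z j) ∧ d j) ≡ false) →
  ∀ i → lookup S i ≡ true → d i ≡ false
codeRows-nonsingular S d rows i S-i = begin
  d i                                        ≡⟨ cong (_∧ d i) (sym S-i) ⟩
  lookup S i ∧ d i                           ≡⟨ sym (sumF-δ i (λ j → lookup S j ∧ d j)) ⟩
  sumF (λ j → δ i j ∧ (lookup S j ∧ d j))   ≡⟨ sumF-cong (λ j → sym (∧-xor-∧-not (lookup S j) (d j) (δ i j))) ⟩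
  sumF (λ j → (lookup S j ∧ d j) xor ((lookup S j ∧ not (δ i j)) ∧ d j))
    ≡⟨ sumF-xor (λ j → lookup S j ∧ d j) (λ j → (lookup S j ∧ not (δ i j)) ∧ d j) ⟩
  sumF (λ j → lookup S j ∧ d j) xor sumF (λ j → (lookup S j ∧ not (δ i j)) ∧ d j)
    ≡⟨ cong₂ _xor_ (trans (sumF-cong (λ j → cong (_∧ d j) (sym (entryBit-nothing S j)))) (rows nothing _))
                   (trans (sumF-cong (λ j → cong (_∧ d j) (sym (entryBit-just S i j)))) (rows (just i) S-i)) ⟩
  false                                      ∎
  where open ≡-Reasoning

-- The row applies G to x and y alike, since they agree outside S.
codeRow-annihilates : ∀ {n r} {L : List (Vec Bool n)} → IsSolution (codeMatrix n r) L →
  ∀ {x y} → x ∈ L → y ∈ L → ∀ {S} (∣S∣≡r : ∣ S ∣ ≡ r) z (ok : ZeroOK S z) → lookup (x ⊕ y) ⊆ lookup S →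
  sumF (λ j → entryBit (codeEntry S z j) ∧ lookup (x ⊕ y) j) ≡ false
codeRow-annihilates {n} {r} (M , completion , G , consistent , satisfies) {x} {y} x∈L y∈L {S} ∣S∣≡r z ok d⊆S = begin
  sumF (λ j → entryBit (codeEntry S z j) ∧ lookup (x ⊕ y) j) ≡⟨ sumF-cong bits ⟩
  mulVec M (x ⊕ y) ρ                                        ≡⟨ mulVec-⊕ M x y ρ ⟩
  mulVec M x ρ xor mulVec M y ρ                             ≡⟨ cong₂ _xor_ (All.lookup satisfies x∈L ρ) (All.lookup satisfies y∈L ρ) ⟩
  G ρ x xor G ρ y                                           ≡⟨ cong (_xor G ρ y) (consistent ρ x y same-outside) ⟩
  G ρ y xor G ρ y                                           ≡⟨ xor-same (G ρ y) ⟩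
  false                                                     ∎
  where
  open ≡-Reasoning
  ρ : CodeRow n r
  ρ = S , ∣S∣≡r , z , ok
  same-outside : ∀ j → codeEntry S z j ≡ ⋆ → lookup x j ≡ lookup y j
  same-outside j ⋆-entry = xor≡false⇒≡ (trans (sym (lookup-⊕ x y j))
                             (⊆-outside d⊆S (¬-not (λ S-j → codeEntry-∈ S z S-j ⋆-entry))))
  bits : ∀ j → entryBit (codeEntry S z j) ∧ lookup (x ⊕ y) j ≡ M ρ j ∧ lookup (x ⊕ y) j
  bits j with lookup (x ⊕ y) j in d-j
  ... | false = trans (∧-zeroʳ _) (sym (∧-zeroʳ _))
  ... | true = trans (∧-identityʳ _) (trans (sym (entryBit-fits (completion ρ j) (codeEntry-∈ S z (d⊆S j d-j))))
                                            (sym (∧-identityʳ _)))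

solution-separated : ∀ {n r} {L : List (Vec Bool n)} → IsSolution (codeMatrix n r) L → r ≤ n →
                     ∀ {x y} → x ∈ L → y ∈ L → ∣ x ⊕ y ∣ ≤ r → x ≡ y
solution-separated {n} {r} solution r≤n {x} {y} x∈L y∈L d≤r
  with S , ∣S∣≡r , d⊆S ← extend-⊆ (x ⊕ y) d≤r r≤n =
  lookup-injective (λ j → xor≡false⇒≡ (trans (sym (lookup-⊕ x y j)) (d≡false j)))
  where
  d≡false : ∀ j → lookup (x ⊕ y) j ≡ false
  d≡false j with lookup S j in S-j
  ... | true = codeRows-nonsingular S (lookup (x ⊕ y))
                 (λ z ok → codeRow-annihilates solution x∈L y∈L ∣S∣≡r z ok d⊆S) j S-j
  ... | false = ⊆-outside d⊆S S-j

-- Counting words; packing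

allWords : ∀ m → List (Vec Bool m)
allWords zero = [] ∷ []
allWords (suc m) = map (true ∷_) (allWords m) List.++ map (false ∷_) (allWords m)

∈-allWords : ∀ {m} (v : Vec Bool m) → v ∈ allWords m
∈-allWords [] = here refl
∈-allWords (true ∷ v) = ∈-++⁺ˡ (∈-map⁺ (true ∷_) (∈-allWords v))
∈-allWords (false ∷ v) = ∈-++⁺ʳ (map (true ∷_) (allWords _)) (∈-map⁺ (false ∷_) (∈-allWords v))

length-allWords : ∀ m → length (allWords m) ≡ 2 ^ m
length-allWords zero = refl
length-allWords (suc m) = begin
  length (map (true ∷_) (allWords m) List.++ map (false ∷_) (allWords m))
    ≡⟨ length-++ (map (true ∷_) (allWords m)) ⟩
  length (map (true ∷_) (allWords m)) + length (map (false ∷_) (allWords m))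
    ≡⟨ cong₂ _+_ (length-map (true ∷_) (allWords m)) (length-map (false ∷_) (allWords m)) ⟩
  length (allWords m) + length (allWords m)
    ≡⟨ cong₂ _+_ (length-allWords m) (trans (length-allWords m) (sym (+-identityʳ (2 ^ m)))) ⟩
  2 ^ suc m ∎
  where open ≡-Reasoning

unique-allWords : ∀ m → Unique (allWords m)
unique-allWords zero = All.[] ∷ []
unique-allWords (suc m) =
  Unique.++⁺ (Unique.map⁺ ∷-injectiveʳ (unique-allWords m)) (Unique.map⁺ ∷-injectiveʳ (unique-allWords m)) disjoint
  where
  disjoint : ∀ {v} → ¬ (v ∈ map (true ∷_) (allWords m) × v ∈ map (false ∷_) (allWords m))
  disjoint (v∈₁ , v∈₂) with ∈-map⁻ (true ∷_) v∈₁ | ∈-map⁻ (false ∷_) v∈₂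
  ... | _ , _ , refl | _ , _ , ()

unique-lookup-injective : ∀ {A : Set} {xs : List A} → Unique xs →
                          ∀ {i j} → List.lookup xs i ≡ List.lookup xs j → i ≡ j
unique-lookup-injective (_ ∷ _) {zero} {zero} _ = refl
unique-lookup-injective (x∉xs ∷ _) {zero} {suc j} eq = ⊥-elim (All.lookup x∉xs (∈-lookup j) eq)
unique-lookup-injective (x∉xs ∷ _) {suc i} {zero} eq = ⊥-elim (All.lookup x∉xs (∈-lookup i) (sym eq))
unique-lookup-injective (_ ∷ unique) {suc i} {suc j} eq = cong suc (unique-lookup-injective unique eq)

-- Sending the i-th entry of xs to its position in ys is injective.
unique-⊆⇒length≤ : ∀ {A : Set} {xs ys : List A} → Unique xs → (∀ {x} → x ∈ xs → x ∈ ys) →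
                   length xs ≤ length ys
unique-⊆⇒length≤ {xs = xs} {ys} unique xs⊆ys = Fin.injective⇒≤ position-injective
  where
  position : Fin (length xs) → Fin (length ys)
  position i = index (xs⊆ys (∈-lookup i))
  position-injective : ∀ {i j} → position i ≡ position j → i ≡ j
  position-injective {i} {j} eq = unique-lookup-injective unique (begin
    List.lookup xs i           ≡⟨ lookup-index (xs⊆ys (∈-lookup i)) ⟩
    List.lookup ys (position i) ≡⟨ cong (List.lookup ys) eq ⟩
    List.lookup ys (position j) ≡⟨ sym (lookup-index (xs⊆ys (∈-lookup j))) ⟩
    List.lookup xs j           ∎)
    where open ≡-Reasoning

unique-length≤ : ∀ {m} {xs : List (Vec Bool m)} → Unique xs → length xs ≤ 2 ^ m
unique-length≤ {m} unique =
  ≤-trans (unique-⊆⇒length≤ unique (λ {v} _ → ∈-allWords v)) (≤-reflexive (length-allWords m))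

_∈?_ : ∀ {m} (v : Vec Bool m) (L : List (Vec Bool m)) → Dec (v ∈ L)
v ∈? L = any? (≡-dec _≟ᵇ_ v) L

fresh-word : ∀ {m} (L : List (Vec Bool m)) → length L < 2 ^ m → Σ (Vec Bool m) (_∉ L)
fresh-word {m} L short with All.all? (_∈? L) (allWords m)
... | yes all∈L = ⊥-elim (<⇒≱ short (subst (_≤ length L) (length-allWords m)
                    (unique-⊆⇒length≤ (unique-allWords m) (All.lookup all∈L))))
... | no ¬all∈L = satisfied (¬All⇒Any¬ (_∈? L) (allWords m) ¬all∈L)

unique-map : ∀ {A B : Set} (f : A → B) {xs : List A} → Unique xs →
             (∀ {x y} → x ∈ xs → y ∈ xs → f x ≡ f y → x ≡ y) → Unique (map f xs)
unique-map f [] _ = []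
unique-map f (x∉xs ∷ unique) injective =
  All.tabulate (λ y∈ fx≡ → let (y , y∈xs , fy≡) = ∈-map⁻ f y∈ in
                  All.lookup x∉xs y∈xs (injective (here refl) (there y∈xs) (trans fx≡ fy≡)))
  ∷ unique-map f unique (λ x∈ y∈ → injective (there x∈) (there y∈))

length-cartesianProductWith : ∀ {A B C : Set} (f : A → B → C) (xs : List A) (ys : List B) →
                              length (cartesianProductWith f xs ys) ≡ length xs * length ys
length-cartesianProductWith f [] ys = refl
length-cartesianProductWith f (x ∷ xs) ys =
  trans (length-++ (map (f x) ys)) (cong₂ _+_ (length-map (f x) ys) (length-cartesianProductWith f xs ys))

Diameter≤ : ∀ {n} → ℕ → List (Vec Bool n) → Set
Diameter≤ D F = ∀ {u v} → u ∈ F → v ∈ F → ∣ u ⊕ v ∣ ≤ D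

-- (x, f) ↦ x ⊕ f is injective on L × F.
packing : ∀ {n r} {L F : List (Vec Bool n)} → Unique L → Unique F → Diameter≤ r F →
          (∀ {x y} → x ∈ L → y ∈ L → ∣ x ⊕ y ∣ ≤ r → x ≡ y) → length L * length F ≤ 2 ^ n
packing {n} {L = L} {F} unique-L unique-F diameter separated = begin
  length L * length F                                ≡⟨ sym (length-cartesianProductWith _,_ L F) ⟩
  length (cartesianProduct L F)                      ≡⟨ sym (length-map sum (cartesianProduct L F)) ⟩
  length (map sum (cartesianProduct L F))            ≤⟨ unique-length≤ (unique-map sum (Unique.cartesianProduct⁺ unique-L unique-F) sum-injective) ⟩
  2 ^ n                                              ∎
  where
  open Data.Nat.Properties.≤-Reasoning
  sum : Vec Bool n × Vec Bool n → Vec Bool n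
  sum (x , f) = x ⊕ f
  sum-injective : ∀ {p q} → p ∈ cartesianProduct L F → q ∈ cartesianProduct L F → sum p ≡ sum q → p ≡ q
  sum-injective {x , f} {x′ , f′} p∈ q∈ eq
    with x∈L , f∈F ← ∈-cartesianProduct⁻ L F p∈ | x′∈L , f′∈F ← ∈-cartesianProduct⁻ L F q∈ =
    cong₂ _,_ x≡x′ f≡f′
    where
    shift : x ⊕ x′ ≡ f ⊕ f′
    shift = ⊕≡zeros⇒≡ (trans (⊕-interchange x x′ f f′) (trans (cong (_⊕ (x′ ⊕ f′)) eq) (⊕-self (x′ ⊕ f′))))
    x≡x′ : x ≡ x′
    x≡x′ = separated x∈L x′∈L (subst (λ z → ∣ z ∣ ≤ _) (sym shift) (diameter f∈F f′∈F))
    f≡f′ : f ≡ f′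
    f≡f′ = ⊕≡zeros⇒≡ (trans (sym shift) (trans (cong (x ⊕_) (sym x≡x′)) (⊕-self x)))

-- Families of words of small diameter

∣zeros∣ : ∀ m → ∣ zeros {m} ∣ ≡ 0
∣zeros∣ zero = refl
∣zeros∣ (suc m) = ∣zeros∣ m

∣++∣ : ∀ {m k} (u : Vec Bool m) (v : Vec Bool k) → ∣ u ++ v ∣ ≡ ∣ u ∣ + ∣ v ∣
∣++∣ [] v = refl
∣++∣ (true ∷ u) v = cong suc (∣++∣ u v)
∣++∣ (false ∷ u) v = ∣++∣ u v

∣⊕∣≤ : ∀ {m} (u v : Vec Bool m) → ∣ u ⊕ v ∣ ≤ ∣ u ∣ + ∣ v ∣
∣⊕∣≤ [] [] = z≤n
∣⊕∣≤ (true ∷ u) (true ∷ v) = ≤-trans (∣⊕∣≤ u v) (m≤n⇒m≤1+n (+-monoʳ-≤ ∣ u ∣ (n≤1+n ∣ v ∣)))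
∣⊕∣≤ (true ∷ u) (false ∷ v) = s≤s (∣⊕∣≤ u v)
∣⊕∣≤ (false ∷ u) (true ∷ v) = ≤-trans (s≤s (∣⊕∣≤ u v)) (≤-reflexive (sym (+-suc _ _)))
∣⊕∣≤ (false ∷ u) (false ∷ v) = ∣⊕∣≤ u v

⊕-++ : ∀ {m k} (u v : Vec Bool m) (u′ v′ : Vec Bool k) → (u ++ u′) ⊕ (v ++ v′) ≡ (u ⊕ v) ++ (u′ ⊕ v′)
⊕-++ [] [] u′ v′ = refl
⊕-++ (a ∷ u) (b ∷ v) u′ v′ = cong ((a xor b) ∷_) (⊕-++ u v u′ v′)

record Family (m D N : ℕ) : Set where
  constructor family
  field
    words : List (Vec Bool m)
    unique : Unique words
    diameter : Diameter≤ D words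
    size : length words ≡ N

open Family

infixr 7 _⊗_

_⊗_ : ∀ {m m′ D D′ N N′} → Family m D N → Family m′ D′ N′ → Family (m + m′) (D + D′) (N * N′)
F ⊗ F′ = family
  (cartesianProductWith _++_ (words F) (words F′))
  (Unique.cartesianProductWith⁺ _++_ (λ {w} {x} → ++-injective w x) (unique F) (unique F′))
  diameter-⊗
  (trans (length-cartesianProductWith _++_ (words F) (words F′)) (cong₂ _*_ (size F) (size F′)))
  where
  diameter-⊗ : Diameter≤ _ (cartesianProductWith _++_ (words F) (words F′))
  diameter-⊗ u∈ v∈
    with a , a′ , a∈ , a′∈ , refl ← ∈-cartesianProductWith⁻ _++_ (words F) (words F′) u∈
       | c , c′ , c∈ , c′∈ , refl ← ∈-cartesianProductWith⁻ _++_ (words F) (words F′) v∈ =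
    ≤-trans (≤-reflexive (trans (cong ∣_∣ (⊕-++ a c a′ c′)) (∣++∣ (a ⊕ c) (a′ ⊕ c′))))
            (+-mono-≤ (diameter F a∈ c∈) (diameter F′ a′∈ c′∈))

pad : ∀ {m D N} k → Family m D N → Family (m + k) D N
pad k F = family
  (map (_++ zeros) (words F))
  (Unique.map⁺ (λ {u} {v} → ++-injectiveˡ u v) (unique F))
  diameter-pad
  (trans (length-map (_++ zeros) (words F)) (size F))
  where
  diameter-pad : Diameter≤ _ (map (_++ zeros) (words F))
  diameter-pad u∈ v∈ with u , u∈F , refl ← ∈-map⁻ (_++ zeros) u∈ | v , v∈F , refl ← ∈-map⁻ (_++ zeros) v∈ =
    ≤-trans (≤-reflexive (begin
      ∣ (u ++ zeros) ⊕ (v ++ zeros) ∣      ≡⟨ cong ∣_∣ (⊕-++ u v zeros zeros) ⟩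
      ∣ (u ⊕ v) ++ (zeros {k} ⊕ zeros) ∣   ≡⟨ ∣++∣ (u ⊕ v) (zeros {k} ⊕ zeros) ⟩
      ∣ u ⊕ v ∣ + ∣ zeros {k} ⊕ zeros ∣    ≡⟨ cong (λ z → ∣ u ⊕ v ∣ + ∣ z ∣) (⊕-self (zeros {k})) ⟩
      ∣ u ⊕ v ∣ + ∣ zeros {k} ∣            ≡⟨ trans (cong (∣ u ⊕ v ∣ +_) (∣zeros∣ k)) (+-identityʳ _) ⟩
      ∣ u ⊕ v ∣                             ∎))
      (diameter F u∈F v∈F)
    where open ≡-Reasoning

widen : ∀ {m D D′ N} → D ≤ D′ → Family m D N → Family m D′ N
widen D≤D′ (family ws unique-ws diameter-ws size-ws) =
  family ws unique-ws (λ u∈ v∈ → ≤-trans (diameter-ws u∈ v∈) D≤D′) size-ws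

pairFamily : Family 1 1 2
pairFamily = family ((true ∷ []) ∷ (false ∷ []) ∷ []) (((λ ()) All.∷ All.[]) ∷ All.[] ∷ []) diameter-pair refl
  where
  diameter-pair : Diameter≤ 1 ((true ∷ []) ∷ (false ∷ []) ∷ [])
  diameter-pair (here refl) (here refl) = z≤n
  diameter-pair (here refl) (there (here refl)) = ≤-refl
  diameter-pair (there (here refl)) (here refl) = ≤-refl
  diameter-pair (there (here refl)) (there (here refl)) = z≤n

unitWords : ∀ b → List (Vec Bool b)
unitWords zero = [] ∷ []
unitWords (suc b) = (true ∷ zeros) ∷ map (false ∷_) (unitWords b)

∣unitWord∣≤1 : ∀ b {u} → u ∈ unitWords b → ∣ u ∣ ≤ 1
∣unitWord∣≤1 zero (here refl) = z≤n
∣unitWord∣≤1 (suc b) (here refl) = s≤s (≤-reflexive (∣zeros∣ b))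
∣unitWord∣≤1 (suc b) (there u∈) with u , u∈′ , refl ← ∈-map⁻ (false ∷_) u∈ = ∣unitWord∣≤1 b u∈′

unitFamily : ∀ b → Family b 2 (suc b)
unitFamily b = family (unitWords b) (unique-unitWords b)
  (λ {u} {v} u∈ v∈ → ≤-trans (∣⊕∣≤ u v) (+-mono-≤ (∣unitWord∣≤1 b u∈) (∣unitWord∣≤1 b v∈)))
  (length-unitWords b)
  where
  unique-unitWords : ∀ b → Unique (unitWords b)
  unique-unitWords zero = All.[] ∷ []
  unique-unitWords (suc b) =
    All.tabulate (λ u∈ eq → case ∈-map⁻ (false ∷_) u∈ of λ { (_ , _ , refl) → case eq of λ () })
    ∷ Unique.map⁺ ∷-injectiveʳ (unique-unitWords b)
  length-unitWords : ∀ b → length (unitWords b) ≡ suc b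
  length-unitWords zero = refl
  length-unitWords (suc b) = cong suc (trans (length-map (false ∷_) (unitWords b)) (length-unitWords b))

blockFamily : ∀ e b → Family (e * b) (e * 2) (suc b ^ e)
blockFamily zero b = family ([] ∷ []) (All.[] ∷ []) (λ { (here refl) (here refl) → z≤n }) refl
blockFamily (suc e) b = unitFamily b ⊗ blockFamily e b

-- Greedy choice of r-wise independent columns

sumList : ∀ {t} → List (Vec Bool t) → Vec Bool t
sumList = List.foldr _⊕_ zeros

sumList-─ : ∀ {t} {P : Vec Bool t → Set} {ys : List (Vec Bool t)} (p : Any P ys) →
            sumList ys ≡ Any.lookup p ⊕ sumList (ys ─ p)
sumList-─ (here _) = refl
sumList-─ {ys = y ∷ ys} (there p) = begin
  y ⊕ sumList ys                               ≡⟨ cong (y ⊕_) (sumList-─ p) ⟩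
  y ⊕ (Any.lookup p ⊕ sumList (ys ─ p))        ≡⟨ sym (⊕-assoc y _ _) ⟩
  (y ⊕ Any.lookup p) ⊕ sumList (ys ─ p)        ≡⟨ cong (_⊕ sumList (ys ─ p)) (⊕-comm y (Any.lookup p)) ⟩
  (Any.lookup p ⊕ y) ⊕ sumList (ys ─ p)        ≡⟨ ⊕-assoc (Any.lookup p) y _ ⟩
  Any.lookup p ⊕ (y ⊕ sumList (ys ─ p))        ∎
  where open ≡-Reasoning

-- A list containing the sums of at most s words from the blocks Ks: either no word of the first block K
-- is used, or one is split off and at most s - 1 further words remain.  Its length is bounded in
-- terms of the block sizes and the number of blocks rather than the total number of words.
sums : ∀ {t} → ℕ → List (List (Vec Bool t)) → List (Vec Bool t)
sums zero Ks = zeros ∷ []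
sums (suc s) [] = zeros ∷ []
sums (suc s) (K ∷ Ks) = sums (suc s) Ks List.++ cartesianProductWith _⊕_ K (sums s (K ∷ Ks))

zeros∈sums : ∀ {t} s (Ks : List (List (Vec Bool t))) → zeros ∈ sums s Ks
zeros∈sums zero Ks = here refl
zeros∈sums (suc s) [] = here refl
zeros∈sums (suc s) (K ∷ Ks) = ∈-++⁺ˡ (zeros∈sums (suc s) Ks)

∈-sums : ∀ {t} s (Ks : List (List (Vec Bool t))) (ys : List (Vec Bool t)) → length ys ≤ s →
         All (λ y → Any (y ∈_) Ks) ys → sumList ys ∈ sums s Ks
∈-sums s Ks [] _ _ = zeros∈sums s Ks
∈-sums zero Ks (y ∷ ys) () _
∈-sums (suc s) [] (y ∷ ys) _ (() All.∷ _)
∈-sums (suc s) (K ∷ Ks) ys ys≤ ys∈ = [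
    (λ y∈K → subst (_∈ sums (suc s) (K ∷ Ks)) (sym (sumList-─ y∈K))
      (∈-++⁺ʳ (sums (suc s) Ks) (∈-cartesianProductWith⁺ _⊕_ (lookup-result y∈K)
        (∈-sums s (K ∷ Ks) (ys ─ y∈K) (≤-pred (subst (_≤ suc s) (length-removeAt′ ys (index y∈K)) ys≤))
                (─⁺ y∈K ys∈))))) ,
    (λ ¬y∈K → ∈-++⁺ˡ (∈-sums (suc s) Ks ys ys≤ (All.zipWith in-Ks (¬Any⇒All¬ ys ¬y∈K , ys∈))))
  ]′ (toSum (any? (_∈? K) ys))
  where
  in-Ks : ∀ {y} → y ∉ K × Any (y ∈_) (K ∷ Ks) → Any (y ∈_) Ks
  in-Ks (y∉K , here y∈K) = ⊥-elim (y∉K y∈K)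
  in-Ks (_ , there y∈Ks) = y∈Ks

length-sums : ∀ {t} β s (Ks : List (List (Vec Bool t))) → 1 ≤ β → All (λ K → length K ≤ β) Ks →
              length (sums s Ks) ≤ (2 * β) ^ s * 2 ^ length Ks
length-sums β zero Ks _ _ = ≤-trans (m^n>0 2 (length Ks)) (≤-reflexive (sym (+-identityʳ _)))
length-sums β (suc s) [] β≥1 _ =
  ≤-trans (m^n>0 (2 * β) {{>-nonZero (≤-trans β≥1 (m≤m+n β _))}} (suc s)) (≤-reflexive (sym (*-identityʳ _)))
length-sums β (suc s) (K ∷ Ks) β≥1 (K≤β All.∷ Ks≤β) = begin
  length (sums (suc s) Ks List.++ cartesianProductWith _⊕_ K (sums s (K ∷ Ks)))
    ≡⟨ length-++ (sums (suc s) Ks) ⟩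
  length (sums (suc s) Ks) + length (cartesianProductWith _⊕_ K (sums s (K ∷ Ks)))
    ≡⟨ cong (length (sums (suc s) Ks) +_) (length-cartesianProductWith _⊕_ K (sums s (K ∷ Ks))) ⟩
  length (sums (suc s) Ks) + length K * length (sums s (K ∷ Ks))
    ≤⟨ +-mono-≤ (length-sums β (suc s) Ks β≥1 Ks≤β) (*-mono-≤ K≤β (length-sums β s (K ∷ Ks) β≥1 (K≤β All.∷ Ks≤β))) ⟩
  (2 * β * (2 * β) ^ s) * 2 ^ length Ks + β * ((2 * β) ^ s * (2 * 2 ^ length Ks))
    ≡⟨ double β ((2 * β) ^ s) (2 ^ length Ks) ⟩
  (2 * β * (2 * β) ^ s) * (2 * 2 ^ length Ks) ∎
  where
  open Data.Nat.Properties.≤-Reasoning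
  double : ∀ b p q → (2 * b * p) * q + b * (p * (2 * q)) ≡ (2 * b * p) * (2 * q)
  double = solve-∀

Independent : ∀ {t} → ℕ → List (Vec Bool t) → Set
Independent s cols = ∀ ys → ys ⊑ cols → length ys ≤ suc s → sumList ys ≡ zeros → ys ≡ []

-- Greedy (Gilbert–Varshamov) choice of columns, in at most B blocks of at most β columns: a new column
-- only has to avoid the sums of at most s previous ones, and there are fewer of those than 2 ^ t.
module Greedy {t} (β s B : ℕ) (β≥1 : 1 ≤ β) (room : (2 * β) ^ s * 2 ^ B < 2 ^ t) where

  Invariant : List (List (Vec Bool t)) → Set
  Invariant Ks = All (λ K → length K ≤ β) Ks × Independent s (List.concat Ks)

  extend : ∀ K Ks → length K < β → length (K ∷ Ks) ≤ B → Invariant (K ∷ Ks) →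
           Σ (Vec Bool t) λ v → Invariant ((v ∷ K) ∷ Ks)
  extend K Ks K<β K∷Ks≤B (K≤β All.∷ Ks≤β , independent) = v , (K<β All.∷ Ks≤β) , independent′
    where
    fewSums : length (sums s (K ∷ Ks)) < 2 ^ t
    fewSums = ≤-<-trans (length-sums β s (K ∷ Ks) β≥1 (K≤β All.∷ Ks≤β))
                        (≤-<-trans (*-monoʳ-≤ ((2 * β) ^ s) (^-monoʳ-≤ 2 K∷Ks≤B)) room)
    v : Vec Bool t
    v = proj₁ (fresh-word (sums s (K ∷ Ks)) fewSums)
    independent′ : Independent s (v ∷ List.concat (K ∷ Ks))
    independent′ ys (_ ∷ʳ ys⊑) ys≤ ys≡0 = independent ys ys⊑ ys≤ ys≡0
    independent′ (_ ∷ ys) (refl ∷ ys⊑) (s≤s ys≤) v+ys≡0 =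
      ⊥-elim (proj₂ (fresh-word (sums s (K ∷ Ks)) fewSums)
        (subst (_∈ sums s (K ∷ Ks)) (sym (⊕≡zeros⇒≡ v+ys≡0))
          (∈-sums s (K ∷ Ks) ys ys≤ (All.tabulate (λ y∈ys → ∈-concat⁻ (K ∷ Ks) (Sublist.lookup ys⊑ y∈ys))))))

  fill : ∀ m K Ks → length K + m ≤ β → length (K ∷ Ks) ≤ B → Invariant (K ∷ Ks) →
         Σ (List (Vec Bool t)) λ K′ → length K′ ≡ length K + m × Invariant (K′ ∷ Ks)
  fill zero K Ks _ _ inv = K , sym (+-identityʳ (length K)) , inv
  fill (suc m) K Ks K+m+1≤β K∷Ks≤B inv = grow (subst (_≤ β) (+-suc (length K) m) K+m+1≤β)
    where
    grow : suc (length K) + m ≤ β → Σ (List (Vec Bool t)) λ K′ → length K′ ≡ length K + suc m × Invariant (K′ ∷ Ks)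
    grow [1+K]+m≤β with extend K Ks (≤-<-trans (m≤m+n (length K) m) [1+K]+m≤β) K∷Ks≤B inv
    ... | v , inv′ with fill m (v ∷ K) Ks [1+K]+m≤β K∷Ks≤B inv′
    ...   | K′ , K′≡ , inv″ = K′ , trans K′≡ (sym (+-suc (length K) m)) , inv″

  blocks : ∀ b → b ≤ B → Σ (List (List (Vec Bool t))) λ Ks →
           length Ks ≡ b × length (List.concat Ks) ≡ b * β × Invariant Ks
  blocks zero _ = [] , refl , refl , All.[] , λ { [] [] _ _ → refl }
  blocks (suc b) b<B with blocks b (≤-trans (n≤1+n b) b<B)
  ... | Ks , refl , concat≡ , inv with fill β [] Ks ≤-refl b<B (z≤n All.∷ proj₁ inv , proj₂ inv)
  ...   | K , K≡β , inv′ = K ∷ Ks , refl , trans (length-++ K) (cong₂ _+_ K≡β concat≡) , inv′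

prefix : ∀ {A : Set} n (xs : List A) → n ≤ length xs → Σ (Fin n → A) λ h → List.tabulate h ⊑ xs
prefix zero xs _ = (λ ()) , minimum xs
prefix (suc n) (x ∷ xs) (s≤s n≤) with prefix n xs n≤
... | h , h⊑ = (λ { zero → x ; (suc j) → h j }) , (refl ∷ h⊑)

select : ∀ {n} {A : Set} → (Fin n → Bool) → (Fin n → A) → List A
select {zero} c h = []
select {suc n} c h = if c zero then h zero ∷ select (c ∘ suc) (h ∘ suc) else select (c ∘ suc) (h ∘ suc)

select-⊑ : ∀ {n} {A : Set} (c : Fin n → Bool) (h : Fin n → A) → select c h ⊑ List.tabulate h
select-⊑ {zero} c h = minimum []
select-⊑ {suc n} c h with c zero
... | true = refl ∷ select-⊑ (c ∘ suc) (h ∘ suc)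
... | false = h zero ∷ʳ select-⊑ (c ∘ suc) (h ∘ suc)

length-select : ∀ {n} {A : Set} (c : Fin n → Bool) (h : Fin n → A) → length (select c h) ≡ count c
length-select {zero} c h = refl
length-select {suc n} c h with c zero
... | true = cong suc (length-select (c ∘ suc) (h ∘ suc))
... | false = length-select (c ∘ suc) (h ∘ suc)

sumList-select : ∀ {n t} (c : Fin n → Bool) (h : Fin n → Vec Bool t) → sumList (select c h) ≡ lincomb c h
sumList-select {zero} c h = refl
sumList-select {suc n} c h with c zero
... | true = cong₂ _⊕_ (sym (·-identityˡ (h zero))) (sumList-select (c ∘ suc) (h ∘ suc))
... | false = trans (sumList-select (c ∘ suc) (h ∘ suc))
                    (sym (trans (cong (_⊕ lincomb (c ∘ suc) (h ∘ suc)) (·-zeroˡ (h zero))) (⊕-identityˡ _)))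

independent-columns : ∀ {t} β s B n → 1 ≤ β → (2 * β) ^ s * 2 ^ B < 2 ^ t → n ≤ B * β →
                      Σ (Fin n → Vec Bool t) (RWiseIndependent (suc s))
independent-columns β s B n β≥1 room n≤Bβ with Greedy.blocks β s B β≥1 room B ≤-refl
... | Ks , _ , length-columns , _ , independent
  with prefix n (List.concat Ks) (subst (n ≤_) (sym length-columns) n≤Bβ)
...   | h , h⊑columns = h , λ c c≤ c-dependent →
  count≡0⇒false c (trans (sym (length-select c h)) (cong length
    (independent (select c h) (⊆-trans (select-⊑ c h) h⊑columns) (subst (_≤ suc s) (sym (length-select c h)) c≤)
                 (trans (sumList-select c h) c-dependent))))

*-distribʳ-^ : ∀ m n o → (m * n) ^ o ≡ m ^ o * n ^ o
*-distribʳ-^ m n zero = refl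
*-distribʳ-^ m n (suc o) = trans (cong ((m * n) *_) (*-distribʳ-^ m n o)) (interchange m n (m ^ o) (n ^ o))
  where
  interchange : ∀ a b x y → (a * b) * (x * y) ≡ (a * x) * (b * y)
  interchange = solve-∀

⌊n/2⌋*2≤n : ∀ n → ⌊ n /2⌋ * 2 ≤ n
⌊n/2⌋*2≤n zero = z≤n
⌊n/2⌋*2≤n (suc zero) = z≤n
⌊n/2⌋*2≤n (suc (suc n)) = s≤s (s≤s (⌊n/2⌋*2≤n n))

n≤1+⌊n/2⌋*2 : ∀ n → n ≤ suc (⌊ n /2⌋ * 2)
n≤1+⌊n/2⌋*2 zero = z≤n
n≤1+⌊n/2⌋*2 (suc zero) = s≤s z≤n
n≤1+⌊n/2⌋*2 (suc (suc n)) = s≤s (s≤s (n≤1+⌊n/2⌋*2 n))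

2^n<2^[1+n] : ∀ n → 2 ^ n < 2 ^ suc n
2^n<2^[1+n] n = ^-monoʳ-< 2 (s≤s (s≤s z≤n)) (n<1+n n)

log₂-bounds : ∀ m → 1 ≤ m → Σ ℕ λ a → 2 ^ a ≤ m × m < 2 ^ suc a
log₂-bounds (suc zero) _ = 0 , ≤-refl , s≤s (s≤s z≤n)
log₂-bounds (suc (suc m)) _ with log₂-bounds (suc m) (s≤s z≤n)
... | a , lower , upper with suc (suc m) <? 2 ^ suc a
...   | yes below = a , m≤n⇒m≤1+n lower , below
...   | no ¬below = suc a , ≤-reflexive (sym power) , subst (_< 2 ^ suc (suc a)) (sym power) (2^n<2^[1+n] (suc a))
  where
  power : suc (suc m) ≡ 2 ^ suc a
  power = ≤-antisym upper (≮⇒≥ ¬below)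

/-bounds : ∀ n e .{{_ : NonZero e}} → n / e * e ≤ n × n < suc (n / e) * e
/-bounds n e = m/n*n≤m n e , (begin-strict
  n                   ≡⟨ m≡m%n+[m/n]*n n e ⟩
  n % e + n / e * e   <⟨ +-monoˡ-< (n / e * e) (m%n<n n e) ⟩
  e + n / e * e       ∎)
  where open Data.Nat.Properties.≤-Reasoning

exponent≤ : ∀ a e s → 1 ≤ a → 1 ≤ e → s ≤ e * 2 → suc ((2 + a) * s + e * 2) ≤ a * (e * 9)
exponent≤ (suc a) (suc e) s _ _ s≤2e = begin
  suc ((3 + a) * s + suc e * 2)            ≤⟨ s≤s (+-monoˡ-≤ (suc e * 2) (*-monoʳ-≤ (3 + a) s≤2e)) ⟩
  suc ((3 + a) * (suc e * 2) + suc e * 2)  ≤⟨ m≤m+n _ (7 * a * e + 7 * a + e) ⟩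
  suc ((3 + a) * (suc e * 2) + suc e * 2) + (7 * a * e + 7 * a + e) ≡⟨ identity a e ⟩
  suc a * (suc e * 9)                       ∎
  where
  open Data.Nat.Properties.≤-Reasoning
  identity : ∀ a e → suc ((3 + a) * (suc e * 2) + suc e * 2) + (7 * a * e + 7 * a + e) ≡ suc a * (suc e * 9)
  identity = solve-∀

-- The data for |L| ^ q · 2 ^ mr(A) ≤ 2 ^ (q n): mr(A) ≤ t by the columns, |L| · N ≤ 2 ^ n by packing the
-- translates, and 2 ^ t ≤ N ^ q.
record Certificate (q n r : ℕ) : Set where
  field
    t : ℕ
    columns : Fin n → Vec Bool t
    independent : RWiseIndependent r columns
    N : ℕ
    translates : Family n r N
    dimension≤ : 2 ^ t ≤ N ^ q

certified-bound : ∀ {q n r} → Certificate q n r → r ≤ n →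
  (L : List (Vec Bool n)) → Unique L → IsSolution (codeMatrix n r) L →
  (k : ℕ) → IsMinRank (codeMatrix n r) k → length L ^ q * 2 ^ k ≤ 2 ^ (q * n)
certified-bound {q} {n} certificate r≤n L unique-L solution k minRank = begin
  length L ^ q * 2 ^ k     ≤⟨ *-monoʳ-≤ (length L ^ q) (^-monoʳ-≤ 2 (codeMatrix-minRank≤ columns independent minRank)) ⟩
  length L ^ q * 2 ^ t     ≤⟨ *-monoʳ-≤ (length L ^ q) dimension≤ ⟩
  length L ^ q * N ^ q     ≡⟨ sym (*-distribʳ-^ (length L) N q) ⟩
  (length L * N) ^ q       ≤⟨ ^-monoˡ-≤ q packed ⟩
  (2 ^ n) ^ q              ≡⟨ ^-*-assoc 2 n q ⟩
  2 ^ (n * q)              ≡⟨ cong (2 ^_) (*-comm n q) ⟩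
  2 ^ (q * n)              ∎
  where
  open Data.Nat.Properties.≤-Reasoning
  open Certificate certificate
  packed : length L * N ≤ 2 ^ n
  packed = subst (λ z → length L * z ≤ 2 ^ n) (size translates)
             (packing unique-L (unique translates) (diameter translates) (solution-separated solution r≤n))

certificate-r≡1 : ∀ n → Certificate 9 (suc n) 1
certificate-r≡1 n = record
  { t = 2
  ; columns = proj₁ columns
  ; independent = proj₂ columns
  ; N = 2
  ; translates = pad n pairFamily
  ; dimension≤ = ^-monoʳ-≤ 2 {2} {9} (s≤s (s≤s z≤n))
  }
  where
  columns : Σ (Fin (suc n) → Vec Bool 2) (RWiseIndependent 1)
  columns = independent-columns (suc n) 0 1 (suc n) (s≤s z≤n) (2^n<2^[1+n] 1) (≤-reflexive (sym (*-identityˡ (suc n))))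

-- For r ≥ 2 the translates are e = ⌊ r / 2 ⌋ blocks of b = ⌊ n / e ⌋ ≥ 2 unit words, and the columns
-- live in dimension t ≈ (a + 2) r where 2 ^ a ≤ b + 1 < 2 ^ (a + 1).
module Certificate-r≥2 (n r′ : ℕ) (r<n : suc (suc r′) < n) where

  open Data.Nat.Properties.≤-Reasoning

  r s e : ℕ
  r = suc (suc r′)
  s = suc r′
  e = suc ⌊ r′ /2⌋

  e*2≤r : e * 2 ≤ r
  e*2≤r = s≤s (s≤s (⌊n/2⌋*2≤n r′))

  s≤e*2 : s ≤ e * 2
  s≤e*2 = s≤s (n≤1+⌊n/2⌋*2 r′)

  b : ℕ
  b = n / e

  n<[1+b]*e : n < suc b * e
  n<[1+b]*e = proj₂ (/-bounds n e)

  b≥2 : 2 ≤ b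
  b≥2 with 2 ≤? b
  ... | yes b≥2 = b≥2
  ... | no b≱2 = ⊥-elim (n≮n n (<-≤-trans n<[1+b]*e (begin
    suc b * e   ≤⟨ *-monoˡ-≤ e (≰⇒> b≱2) ⟩
    2 * e       ≡⟨ *-comm 2 e ⟩
    e * 2       ≤⟨ e*2≤r ⟩
    r           ≤⟨ <⇒≤ r<n ⟩
    n           ∎)))

  b≥1 : 1 ≤ b
  b≥1 = ≤-trans (n≤1+n 1) b≥2

  a : ℕ
  a = proj₁ (log₂-bounds (suc b) (s≤s z≤n))

  2^a≤1+b : 2 ^ a ≤ suc b
  2^a≤1+b = proj₁ (proj₂ (log₂-bounds (suc b) (s≤s z≤n)))

  1+b<2^[1+a] : suc b < 2 ^ suc a
  1+b<2^[1+a] = proj₂ (proj₂ (log₂-bounds (suc b) (s≤s z≤n)))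

  a≥1 : 1 ≤ a
  a≥1 with a | 1+b<2^[1+a]
  ... | zero | s≤s (s≤s b<1) = ⊥-elim (n≮n 0 (<-≤-trans b≥1 b<1))
  ... | suc _ | _ = s≤s z≤n

  t : ℕ
  t = suc ((2 + a) * s + e * 2)

  room : (2 * b) ^ s * 2 ^ (e * 2) < 2 ^ t
  room = begin-strict
    (2 * b) ^ s * 2 ^ (e * 2)        ≤⟨ *-monoˡ-≤ (2 ^ (e * 2)) (^-monoˡ-≤ s 2b≤2^[2+a]) ⟩
    (2 ^ (2 + a)) ^ s * 2 ^ (e * 2)  ≡⟨ cong (_* 2 ^ (e * 2)) (^-*-assoc 2 (2 + a) s) ⟩
    2 ^ ((2 + a) * s) * 2 ^ (e * 2)  ≡⟨ sym (^-distribˡ-+-* 2 ((2 + a) * s) (e * 2)) ⟩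
    2 ^ ((2 + a) * s + e * 2)        <⟨ 2^n<2^[1+n] ((2 + a) * s + e * 2) ⟩
    2 ^ t                            ∎
    where
    2b≤2^[2+a] : 2 * b ≤ 2 ^ (2 + a)
    2b≤2^[2+a] = *-monoʳ-≤ 2 (<⇒≤ (<-≤-trans (n<1+n b) (<⇒≤ 1+b<2^[1+a])))

  n≤e*2*b : n ≤ e * 2 * b
  n≤e*2*b = begin
    n              ≤⟨ <⇒≤ n<[1+b]*e ⟩
    suc b * e      ≤⟨ *-monoˡ-≤ e (+-monoˡ-≤ b b≥1) ⟩
    (b + b) * e    ≡⟨ rearrange b e ⟩
    e * 2 * b      ∎
    where
    rearrange : ∀ b e → (b + b) * e ≡ e * 2 * b
    rearrange = solve-∀

  e*b≤n : e * b ≤ n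
  e*b≤n = ≤-trans (≤-reflexive (*-comm e b)) (proj₁ (/-bounds n e))

  dimension≤ : 2 ^ t ≤ (suc b ^ e) ^ 9
  dimension≤ = begin
    2 ^ t              ≤⟨ ^-monoʳ-≤ 2 (exponent≤ a e s a≥1 (s≤s z≤n) s≤e*2) ⟩
    2 ^ (a * (e * 9))  ≡⟨ sym (^-*-assoc 2 a (e * 9)) ⟩
    (2 ^ a) ^ (e * 9)  ≤⟨ ^-monoˡ-≤ (e * 9) 2^a≤1+b ⟩
    suc b ^ (e * 9)    ≡⟨ sym (^-*-assoc (suc b) e 9) ⟩
    (suc b ^ e) ^ 9    ∎

  certificate : Certificate 9 n r
  certificate = record
    { t = t
    ; columns = proj₁ (independent-columns b s (e * 2) n b≥1 room n≤e*2*b)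
    ; independent = proj₂ (independent-columns b s (e * 2) n b≥1 room n≤e*2*b)
    ; N = suc b ^ e
    ; translates = widen e*2≤r (subst (λ m → Family m (e * 2) (suc b ^ e)) (m+[n∸m]≡n e*b≤n)
                                      (pad (n ∸ e * b) (blockFamily e b)))
    ; dimension≤ = dimension≤
    }

certificate : ∀ n r → 1 ≤ r → r < n → Certificate 9 n r
certificate zero (suc zero) _ ()
certificate (suc n) (suc zero) _ _ = certificate-r≡1 n
certificate n (suc (suc r′)) _ r<n = Certificate-r≥2.certificate n r′ r<n

lemma15 : Σ ℕ λ p → Σ ℕ λ q → (1 ≤ p) × (1 ≤ q) ×
    (∀ (n r : ℕ) → 1 ≤ r → r < n →
      (L : List (Vec Bool n)) → Unique L → IsSolution (codeMatrix n r) L →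
      (k : ℕ) → IsMinRank (codeMatrix n r) k →
      length L ^ q * 2 ^ (p * k) ≤ 2 ^ (q * n))
lemma15 = 1 , 9 , ≤-refl , s≤s z≤n , λ n r r≥1 r<n L unique-L solution k minRank →
  subst (λ m → length L ^ 9 * 2 ^ m ≤ 2 ^ (9 * n)) (sym (*-identityˡ k))
        (certified-bound (certificate n r r≥1 r<n) (<⇒≤ r<n) L unique-L solution k minRank)
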